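{- Let $(\mathcal{A},B)$ be an instance of \textsc{3-Partition} and let $\mathcal{S}$ be the degree sequence constructed from it as described in the context. If there is a dag realizing $\mathcal{S}$, then $(\mathcal{A},B)$ is a yes-instance of \textsc{3-Partition}.
   Context: \textsc{3-Partition}: given a sequence $\mathcal{A}=a_1,\ldots,a_{3m}$ of positive integers and an integer $B$ with $\sum_{i=1}^{3m}a_i=mB$ and $B/4<a_i<B/2$ for all $i$, decide whether the $3m$ integers can be partitioned into $m$ disjoint triples each summing to $B$. A degree sequence is a multiset of pairs $\binom{a}{b}$ of nonnegative integers ($a$ = prescribed indegree, $b$ = prescribed outdegree); a dag (directed acyclic graph without parallel arcs and self-loops) realizes it if its vertices can be put in bijection with the elements so that each vertex has the indegree and outdegree of its element. Construction: $\mathcal{S}$ is the multiset consisting of $\alpha_i=\binom{a_i}{a_i}$ for $1\le i\le 3m$, together with the elements of $X_0,\ldots,X_m$, where $X_0=\{x_0^j: 0\le j\le B-1\}$ with $x_0^j=\binom{j}{2mB-j}$; $X_m=\{x_m^j:0\le j\le B-1\}$ with $x_m^j=\binom{(2m-1)B+j+1}{B-1-j}$; and for $0<i<m$, $X_i=\{x_i^j:0\le j\le 2B-1\}$ with $x_i^j=\binom{(2i-1)B+j+1}{(2m-2i+1)B-1-j}$ if $j<B$ and $x_i^j=\binom{(2i-1)B+j}{(2m-2i+1)B-j}$ if $j\ge B$. -}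

module Defs where

open import Data.Nat using (ℕ; zero; suc; _+_; _*_; _∸_; _<_; _<ᵇ_)
open import Data.Fin using (Fin; toℕ) renaming (zero to fzero; suc to fsuc)
open import Data.Bool using (Bool; true; false; if_then_else_)
open import Data.List using (List; tabulate; map; concatMap; upTo; length; lookup; _++_)
open import Data.Product using (_×_; _,_; proj₁; proj₂; Σ; ∃; ∃-syntax)
open import Relation.Binary.PropositionalEquality using (_≡_)
open import Relation.Nullary using (¬_)
open import Relation.Binary.Construct.Closure.Transitive using (TransClosure)
open import Function.Definitions using (Injective; Surjective)

sumFin : {n : ℕ} → (Fin n → ℕ) → ℕ
sumFin {zero}  f = 0
sumFin {suc n} f = f fzero + sumFin (λ i → f (fsuc i))

-- A partition into m triples is given by a
-- bijection σ : Fin m × Fin 3 → Fin (3 * m) (triple k consists of the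
-- indices σ (k,0), σ (k,1), σ (k,2)).
YesInstance : (m B : ℕ) → (Fin (3 * m) → ℕ) → Set
YesInstance m B a =
  Σ (Fin m × Fin 3 → Fin (3 * m)) λ σ →
    Injective _≡_ _≡_ σ ×
    (∀ i → ∃[ p ] σ p ≡ i) ×
    (∀ k → a (σ (k , fzero)) + a (σ (k , fsuc fzero)) + a (σ (k , fsuc (fsuc fzero))) ≡ B)

-- A degree sequence: a finite multiset of pairs (indegree , outdegree),
-- represented as a list.
DegSeq : Set
DegSeq = List (ℕ × ℕ)

-- A simple digraph on vertex set Fin n: arc u → v iff E u v ≡ true
-- (so there are no parallel arcs).
Digraph : ℕ → Set
Digraph n = Fin n → Fin n → Bool

Arc : {n : ℕ} → Digraph n → Fin n → Fin n → Set
Arc E u v = E u v ≡ true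

indeg : {n : ℕ} → Digraph n → Fin n → ℕ
indeg E v = sumFin (λ u → if E u v then 1 else 0)

outdeg : {n : ℕ} → Digraph n → Fin n → ℕ
outdeg E u = sumFin (λ v → if E u v then 1 else 0)

IsDag : {n : ℕ} → Digraph n → Set
IsDag {n} E = (∀ v → ¬ Arc E v v) × (∀ v → ¬ TransClosure (Arc E) v v)

-- A dag realizes S: vertices are the positions of S (bijection with the
-- elements of the multiset), each vertex has the prescribed degrees.
Realizes : (S : DegSeq) → Digraph (length S) → Set
Realizes S E = IsDag E ×
  (∀ v → indeg E v ≡ proj₁ (lookup S v) × outdeg E v ≡ proj₂ (lookup S v))

DagRealizable : DegSeq → Set
DagRealizable S = ∃[ E ] Realizes S E

alphas : (m : ℕ) → (Fin (3 * m) → ℕ) → DegSeq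
alphas m a = tabulate (λ i → (a i , a i))

X₀ : (m B : ℕ) → DegSeq
X₀ m B = map (λ j → (j , 2 * m * B ∸ j)) (upTo B)

Xm : (m B : ℕ) → DegSeq
Xm m B = map (λ j → ((2 * m ∸ 1) * B + j + 1 , B ∸ 1 ∸ j)) (upTo B)

Xi : (m B i : ℕ) → DegSeq
Xi m B i = map x (upTo (2 * B))
  where
  x : ℕ → ℕ × ℕ
  x j = if j <ᵇ B
        then ((2 * i ∸ 1) * B + j + 1 , (2 * m ∸ 2 * i + 1) * B ∸ 1 ∸ j)
        else ((2 * i ∸ 1) * B + j     , (2 * m ∸ 2 * i + 1) * B ∸ j)

Xmid : (m B : ℕ) → DegSeq
Xmid m B = concatMap (Xi m B) (map suc (upTo (m ∸ 1)))

constructS : (m B : ℕ) → (Fin (3 * m) → ℕ) → DegSeq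
constructS m B a = alphas m a ++ X₀ m B ++ Xmid m B ++ Xm m B

module Submission where

-- Write N = 2mB and let e p ∈ {0, 1} be the parity of ⌊p / B⌋. Listed in order, the
-- elements of X₀ ∪ … ∪ X_m are exactly (p + e p , N − p − e p) for p < N. Each such vertex
-- has total degree N, but there are only N − 1 other X-vertices, and the α-vertices
-- carry at most Σ 2aᵢ = N arcs to X altogether. Hence X spans a tournament, every
-- X-vertex is joined to exactly one α-vertex, and all arcs at the α-vertices go to X.
-- Being acyclic, the tournament is transitive, so its vertices are ranked 0, …, N − 1 by
-- their in-degree inside X, and the vertex of rank r receives its α-arc iff e r = 1.
-- For θ = 2jB, an α-vertex sending an arc below rank θ receives all its arcs from below θ;
-- counting arcs across this cut shows that these α-vertices have total weight exactly jB.
-- The m successive differences of these sets have weight B, and B/4 < aᵢ < B/2 makes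
-- each of them a triple.

open import Defs
open import Data.Nat
open import Data.Nat.Properties
open import Data.Nat.DivMod using (_/_; _%_; m%n<n; m*n/n≡m; m<n⇒m/n≡0; +-distrib-/-∣ˡ; m*n%n≡0; [m+kn]%n≡m%n)
open import Data.Nat.Divisibility using (n∣m*n)
open import Data.Nat.Tactic.RingSolver using (solve-∀)
open import Data.Fin using (Fin; toℕ; cast; fromℕ<; combine; _↑ˡ_; _↑ʳ_) renaming (zero to fzero; suc to fsuc)
open import Data.Fin.Properties using (toℕ<n; toℕ-injective; toℕ-fromℕ<; toℕ-↑ˡ; toℕ-↑ʳ; toℕ-cast; cast-is-id; combine-injective)
  renaming (_≟_ to _≟ᶠ_; suc-injective to fsuc-injective; 0≢1+n to fzero≢fsuc)
open import Data.Bool using (Bool; true; false; if_then_else_)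
open import Data.List using (List; []; _∷_; concatMap; tabulate; applyUpTo; length; lookup; _++_)
open import Data.List.Properties using (map-upTo; length-++; length-tabulate; lookup-tabulate; length-applyUpTo; lookup-applyUpTo)
open import Data.Product using (_×_; _,_; proj₁; proj₂; Σ; ∃-syntax)
open import Data.Product.Properties using (×-≡,≡→≡; ×-≡,≡←≡)
open import Data.Sum using (_⊎_; inj₁; inj₂)
open import Data.Empty using (⊥-elim)
open import Function.Definitions using (Injective)
open import Relation.Nullary using (Dec; yes; no; ¬_)
open import Relation.Binary using (Tri; tri<; tri≈; tri>)
open import Relation.Binary.PropositionalEquality
open import Relation.Binary.Construct.Closure.Transitive using ([_]; _∷_)
open import Algebra.Properties.CommutativeSemigroup +-commutativeSemigroup using (interchange)

ind : Bool → ℕ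
ind b = if b then 1 else 0

χ : {P : Set} → Dec P → ℕ
χ (yes _) = 1
χ (no _)  = 0

χ≤1 : {P : Set} (d : Dec P) → χ d ≤ 1
χ≤1 (yes _) = ≤-refl
χ≤1 (no _)  = z≤n

χ-yes : {P : Set} (d : Dec P) → P → χ d ≡ 1
χ-yes (yes _) _ = refl
χ-yes (no ¬p) p = ⊥-elim (¬p p)

χ-no : {P : Set} (d : Dec P) → ¬ P → χ d ≡ 0
χ-no (yes p) ¬p = ⊥-elim (¬p p)
χ-no (no _)  _  = refl

χ>0⇒ : {P : Set} (d : Dec P) → 0 < χ d → P
χ>0⇒ (yes p) _ = p

χ≡0⇒ : {P : Set} (d : Dec P) → χ d ≡ 0 → ¬ P
χ≡0⇒ (no ¬p) _ = ¬p

0<ᵇ⇒0< : ∀ {n} → (0 <ᵇ n) ≡ true → 0 < n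
0<ᵇ⇒0< {suc n} _ = z<s

0<⇒0<ᵇ : ∀ {n} → 0 < n → (0 <ᵇ n) ≡ true
0<⇒0<ᵇ z<s = refl

sum-cong : ∀ {n} {f g : Fin n → ℕ} → (∀ i → f i ≡ g i) → sumFin f ≡ sumFin g
sum-cong {zero}  h = refl
sum-cong {suc n} h = cong₂ _+_ (h fzero) (sum-cong (λ i → h (fsuc i)))

sum-+ : ∀ {n} (f g : Fin n → ℕ) → sumFin (λ i → f i + g i) ≡ sumFin f + sumFin g
sum-+ {zero}  f g = refl
sum-+ {suc n} f g = trans (cong (f fzero + g fzero +_) (sum-+ (λ i → f (fsuc i)) (λ i → g (fsuc i))))
                          (interchange (f fzero) (g fzero) _ _)

sum-mono-≤ : ∀ {n} {f g : Fin n → ℕ} → (∀ i → f i ≤ g i) → sumFin f ≤ sumFin g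
sum-mono-≤ {zero}  h = z≤n
sum-mono-≤ {suc n} h = +-mono-≤ (h fzero) (sum-mono-≤ (λ i → h (fsuc i)))

sum-≡⇒≡ : ∀ {n} {f g : Fin n → ℕ} → (∀ i → f i ≤ g i) → sumFin f ≡ sumFin g → ∀ i → f i ≡ g i
sum-≡⇒≡ {suc n} {f} {g} h eq fzero = ≤-antisym (h fzero)
  (+-cancelʳ-≤ _ _ _ (≤-trans (≤-reflexive (sym eq)) (+-monoʳ-≤ (f fzero) (sum-mono-≤ (λ i → h (fsuc i))))))
sum-≡⇒≡ {suc n} {f} {g} h eq (fsuc i) = sum-≡⇒≡ (λ i → h (fsuc i))
  (≤-antisym (sum-mono-≤ (λ i → h (fsuc i)))
             (+-cancelˡ-≤ (f fzero) _ _ (≤-trans (+-monoˡ-≤ _ (h fzero)) (≤-reflexive (sym eq))))) i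

sum-const : ∀ {n} c → sumFin {n} (λ _ → c) ≡ n * c
sum-const {zero}  c = refl
sum-const {suc n} c = cong (c +_) (sum-const {n} c)

sum-1 : ∀ {n} → sumFin {n} (λ _ → 1) ≡ n
sum-1 {n} = trans (sum-const {n} 1) (*-identityʳ n)

sum-0 : ∀ {n} → sumFin {n} (λ _ → 0) ≡ 0
sum-0 {n} = trans (sum-const {n} 0) (*-zeroʳ n)

sum-*ˡ : ∀ {n} c (f : Fin n → ℕ) → sumFin (λ i → c * f i) ≡ c * sumFin f
sum-*ˡ {zero}  c f = sym (*-zeroʳ c)
sum-*ˡ {suc n} c f = trans (cong (c * f fzero +_) (sum-*ˡ c (λ i → f (fsuc i)))) (sym (*-distribˡ-+ c _ _))

sum-*ʳ : ∀ {n} c (f : Fin n → ℕ) → sumFin (λ i → f i * c) ≡ sumFin f * c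
sum-*ʳ c f = trans (sum-cong (λ i → *-comm (f i) c)) (trans (sum-*ˡ c f) (*-comm c (sumFin f)))

sum-comm : ∀ {n k} (f : Fin n → Fin k → ℕ) →
  sumFin (λ i → sumFin (λ j → f i j)) ≡ sumFin (λ j → sumFin (λ i → f i j))
sum-comm {zero}  {k} f = sym (sum-0 {k})
sum-comm {suc n} {k} f = trans (cong (sumFin (f fzero) +_) (sum-comm (λ i → f (fsuc i))))
                               (sym (sum-+ (f fzero) (λ j → sumFin (λ i → f (fsuc i) j))))

sum-++ : ∀ k {l} (f : Fin (k + l) → ℕ) → sumFin f ≡ sumFin (λ i → f (i ↑ˡ l)) + sumFin (λ j → f (k ↑ʳ j))
sum-++ zero    f = refl
sum-++ (suc k) f = trans (cong (f fzero +_) (sum-++ k (λ i → f (fsuc i)))) (sym (+-assoc (f fzero) _ _))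

sum-select : ∀ {n} (x : Fin n) (f : Fin n → ℕ) → sumFin (λ v → χ (v ≟ᶠ x) * f v) ≡ f x
sum-select {suc n} fzero f = trans (cong₂ _+_ (+-identityʳ (f fzero)) (sum-0 {n})) (+-identityʳ (f fzero))
sum-select {suc n} (fsuc x) f = trans (sum-cong {n} shift) (sum-select x (λ i → f (fsuc i)))
  where shift : (i : Fin n) → χ (fsuc i ≟ᶠ fsuc x) * f (fsuc i) ≡ χ (i ≟ᶠ x) * f (fsuc i)
        shift i with i ≟ᶠ x
        ... | yes _ = refl
        ... | no _  = refl

sum-δ : ∀ {n} (x : Fin n) → sumFin (λ v → χ (v ≟ᶠ x)) ≡ 1
sum-δ x = trans (sum-cong (λ v → sym (*-identityʳ (χ (v ≟ᶠ x))))) (sum-select x (λ _ → 1))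

sum>0⇒∃ : ∀ {n} (f : Fin n → ℕ) → 0 < sumFin f → ∃[ i ] 0 < f i
sum>0⇒∃ {suc n} f h with f fzero in eq
... | suc _ = fzero , subst (0 <_) (sym eq) z<s
... | zero  = let (i , p) = sum>0⇒∃ (λ i → f (fsuc i)) h in fsuc i , p

-- Counting the values of an injective map

χ<suc : ∀ x b → χ (x <? suc b) ≡ χ (x <? b) + χ (x ≟ b)
χ<suc x b with x <? suc b | x <? b | x ≟ b
... | yes _   | yes x<b | yes x≡b = ⊥-elim (<-irrefl x≡b x<b)
... | yes _   | yes _   | no _    = refl
... | yes _   | no _    | yes _   = refl
... | yes x≤b | no x≮b  | no x≢b  = ⊥-elim (x≢b (≤-antisym (≤-pred x≤b) (≮⇒≥ x≮b)))
... | no x≰b  | yes x<b | _       = ⊥-elim (x≰b (m<n⇒m<1+n x<b))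
... | no x≰b  | no _    | yes x≡b = ⊥-elim (x≰b (s≤s (≤-reflexive x≡b)))
... | no _    | no _    | no _    = refl

count-≡-≤1 : ∀ {n} (f : Fin n → ℕ) → Injective _≡_ _≡_ f → ∀ c → sumFin (λ x → χ (f x ≟ c)) ≤ 1
count-≡-≤1 {zero}  f inj c = z≤n
count-≡-≤1 {suc n} f inj c with f fzero ≟ c
... | yes f0≡c = ≤-reflexive (cong suc (trans (sum-cong miss) (sum-0 {n})))
  where miss : (i : Fin n) → χ (f (fsuc i) ≟ c) ≡ 0
        miss i = χ-no (f (fsuc i) ≟ c) (λ fi≡c → fzero≢fsuc (inj (trans f0≡c (sym fi≡c))))
... | no _ = count-≡-≤1 (λ i → f (fsuc i)) (λ e → fsuc-injective (inj e)) c

count-<-≤ : ∀ {n} (f : Fin n → ℕ) → Injective _≡_ _≡_ f → ∀ b → sumFin (λ x → χ (f x <? b)) ≤ b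
count-<-≤ {n} f inj zero = ≤-reflexive (trans (sum-cong (λ x → χ-no (f x <? 0) λ ())) (sum-0 {n}))
count-<-≤ {n} f inj (suc b) = begin
  sumFin (λ x → χ (f x <? suc b))                          ≡⟨ sum-cong (λ x → χ<suc (f x) b) ⟩
  sumFin (λ x → χ (f x <? b) + χ (f x ≟ b))                ≡⟨ sum-+ (λ x → χ (f x <? b)) (λ x → χ (f x ≟ b)) ⟩
  sumFin (λ x → χ (f x <? b)) + sumFin (λ x → χ (f x ≟ b)) ≤⟨ +-mono-≤ (count-<-≤ f inj b) (count-≡-≤1 f inj b) ⟩
  b + 1                                                    ≡⟨ +-comm b 1 ⟩
  suc b                                                    ∎
  where open ≤-Reasoning

χ-suc : ∀ a b → χ (suc a ≟ suc b) ≡ χ (a ≟ b)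
χ-suc a b with a ≟ b
... | yes refl = χ-yes (suc a ≟ suc a) refl
... | no a≢b   = χ-no (suc a ≟ suc b) (λ e → a≢b (suc-injective e))

module _ {n : ℕ} (f : Fin n → ℕ) (f-inj : Injective _≡_ _≡_ f) where

  module _ (f<n : ∀ x → f x < n) where

    private
      f-rev : Fin n → ℕ
      f-rev x = n ∸ suc (f x)

      f-rev-inj : Injective _≡_ _≡_ f-rev
      f-rev-inj {x} {y} e = f-inj (≤-antisym (rev-≤ e) (rev-≤ (sym e)))
        where
        rev-≤ : ∀ {x y} → f-rev x ≡ f-rev y → f x ≤ f y
        rev-≤ {x} {y} e with f x ≤? f y
        ... | yes fx≤fy = fx≤fy
        ... | no fx≰fy  = ⊥-elim (<-irrefl e (∸-monoʳ-< (s≤s (≰⇒> fx≰fy)) (f<n x)))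

      χ-rev : ∀ x s → s ≤ n → χ (f x <? s) + χ (f-rev x <? n ∸ s) ≡ 1
      χ-rev x s s≤n with f x <? s | f-rev x <? n ∸ s
      ... | yes fx<s | yes r<  = ⊥-elim (<-irrefl refl (≤-<-trans (∸-monoʳ-≤ n fx<s) r<))
      ... | yes _    | no _    = refl
      ... | no _     | yes _   = refl
      ... | no fx≮s  | no r≮   = ⊥-elim (r≮ (rev< n (f x) s (f<n x) s≤n (≮⇒≥ fx≮s)))
        where rev< : ∀ n r s → r < n → s ≤ n → s ≤ r → n ∸ suc r < n ∸ s
              rev< (suc n) r       zero    (s≤s r<n) _         _         = s≤s (m∸n≤m n r)
              rev< (suc n) (suc r) (suc s) (s≤s r<n) (s≤s s≤n) (s≤s s≤r) = rev< n r s r<n s≤n s≤r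

    count-< : ∀ s → s ≤ n → sumFin (λ x → χ (f x <? s)) ≡ s
    count-< s s≤n = ≤-antisym (count-<-≤ f f-inj s) (+-cancelʳ-≤ (n ∸ s) _ _ (begin
      s + (n ∸ s)                                                  ≡⟨ m+[n∸m]≡n s≤n ⟩
      n                                                            ≡⟨ sym sum-1 ⟩
      sumFin {n} (λ _ → 1)                                         ≡⟨ sum-cong (λ x → sym (χ-rev x s s≤n)) ⟩
      sumFin (λ x → χ (f x <? s) + χ (f-rev x <? n ∸ s))           ≡⟨ sum-+ (λ x → χ (f x <? s)) _ ⟩
      sumFin (λ x → χ (f x <? s)) + sumFin (λ x → χ (f-rev x <? n ∸ s))
                                      ≤⟨ +-monoʳ-≤ _ (count-<-≤ f-rev f-rev-inj (n ∸ s)) ⟩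
      sumFin (λ x → χ (f x <? s)) + (n ∸ s)                        ∎))
      where open ≤-Reasoning

    count-≡ : ∀ c → c < n → sumFin (λ x → χ (f x ≟ c)) ≡ 1
    count-≡ c c<n = +-cancelˡ-≡ c _ _ (begin
      c + sumFin (λ x → χ (f x ≟ c))                           ≡⟨ cong (_+ sumFin (λ x → χ (f x ≟ c))) (sym (count-< c (<⇒≤ c<n))) ⟩
      sumFin (λ x → χ (f x <? c)) + sumFin (λ x → χ (f x ≟ c)) ≡⟨ sym (sum-+ (λ x → χ (f x <? c)) _) ⟩
      sumFin (λ x → χ (f x <? c) + χ (f x ≟ c))                ≡⟨ sum-cong (λ x → sym (χ<suc (f x) c)) ⟩
      sumFin (λ x → χ (f x <? suc c))                          ≡⟨ count-< (suc c) c<n ⟩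
      suc c                                                    ≡⟨ +-comm 1 c ⟩
      c + 1                                                    ∎)
      where open ≡-Reasoning

    ∃-preimage : ∀ c → c < n → ∃[ x ] f x ≡ c
    ∃-preimage c c<n =
      let (x , h) = sum>0⇒∃ (λ x → χ (f x ≟ c)) (≤-reflexive (sym (count-≡ c c<n))) in x , χ>0⇒ (f x ≟ c) h

    sum-reindex : (h : ℕ → ℕ) → sumFin (λ x → h (f x)) ≡ sumFin {n} (λ i → h (toℕ i))
    sum-reindex h = begin
      sumFin (λ x → h (f x))                                          ≡⟨ sum-cong (λ x → sym (sum-select-toℕ h (f x) (f<n x))) ⟩
      sumFin (λ x → sumFin {n} (λ i → χ (f x ≟ toℕ i) * h (toℕ i)))   ≡⟨ sum-comm {n} {n} (λ x i → χ (f x ≟ toℕ i) * h (toℕ i)) ⟩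
      sumFin {n} (λ i → sumFin (λ x → χ (f x ≟ toℕ i) * h (toℕ i)))   ≡⟨ sum-cong hit ⟩
      sumFin {n} (λ i → h (toℕ i))                                    ∎
      where
      open ≡-Reasoning
      sum-select-toℕ : ∀ {n} (h : ℕ → ℕ) c → c < n → sumFin {n} (λ i → χ (c ≟ toℕ i) * h (toℕ i)) ≡ h c
      sum-select-toℕ {suc n} h zero    _ = trans (cong₂ _+_ (+-identityʳ (h 0)) (sum-0 {n})) (+-identityʳ (h 0))
      sum-select-toℕ {suc n} h (suc c) (s≤s c<n) =
        trans (cong₂ _+_ (cong (_* h 0) (χ-no (suc c ≟ 0) λ ())) (sum-cong {n} (λ i → cong (_* h (suc (toℕ i))) (χ-suc c (toℕ i)))))
              (sum-select-toℕ (λ x → h (suc x)) c c<n)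
      hit : (i : Fin n) → sumFin (λ x → χ (f x ≟ toℕ i) * h (toℕ i)) ≡ h (toℕ i)
      hit i = trans (sum-*ʳ (h (toℕ i)) (λ x → χ (f x ≟ toℕ i)))
                    (trans (cong (_* h (toℕ i)) (count-≡ (toℕ i) (toℕ<n i))) (+-identityʳ _))

count-≤-threshold : ∀ n (g : ℕ → ℕ) t s → s ≤ n → (∀ i → i < s → g i ≤ t) → (∀ i → s ≤ i → t < g i) →
  sumFin {n} (λ p → χ (g (toℕ p) ≤? t)) ≡ s
count-≤-threshold zero g t zero _ _ _ = refl
count-≤-threshold (suc n) g t s s≤n below above with g 0 ≤? t | s
... | yes g0≤t | zero  = ⊥-elim (<⇒≱ (above 0 z≤n) g0≤t)
... | no _     | zero  = count-≤-threshold n (λ x → g (suc x)) t zero z≤n (λ _ ()) (λ i _ → above (suc i) z≤n)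
... | yes _    | suc s = cong suc (count-≤-threshold n (λ x → g (suc x)) t s (≤-pred s≤n)
                           (λ i i<s → below (suc i) (s≤s i<s)) (λ i s≤i → above (suc i) (s≤s s≤i)))
... | no g0≰t  | suc s = ⊥-elim (g0≰t (below 0 z<s))

sum-toℕ-+ : ∀ m n (g : ℕ → ℕ) →
  sumFin {m + n} (λ k → g (toℕ k)) ≡ sumFin {m} (λ k → g (toℕ k)) + sumFin {n} (λ k → g (m + toℕ k))
sum-toℕ-+ m n g = trans (sum-++ m (λ k → g (toℕ k)))
  (cong₂ _+_ (sum-cong {m} (λ k → cong g (toℕ-↑ˡ k n))) (sum-cong {n} (λ k → cong g (toℕ-↑ʳ m k))))

sum-toℕ-const : ∀ n (g : ℕ → ℕ) c → (∀ i → i < n → g i ≡ c) → sumFin {n} (λ k → g (toℕ k)) ≡ n * c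
sum-toℕ-const n g c g≡c = trans (sum-cong (λ k → g≡c (toℕ k) (toℕ<n k))) (sum-const {n} c)

sum-toℕ-prefix : ∀ n θ (g : ℕ → ℕ) → θ ≤ n →
  sumFin {n} (λ k → χ (toℕ k <? θ) * g (toℕ k)) ≡ sumFin {θ} (λ k → g (toℕ k))
sum-toℕ-prefix n θ g θ≤n = begin
  sumFin {n} (λ k → χ (toℕ k <? θ) * g (toℕ k))
    ≡⟨ cong (λ n → sumFin {n} (λ k → χ (toℕ k <? θ) * g (toℕ k))) (sym (m+[n∸m]≡n θ≤n)) ⟩
  sumFin {θ + (n ∸ θ)} (λ k → χ (toℕ k <? θ) * g (toℕ k))
    ≡⟨ sum-toℕ-+ θ (n ∸ θ) (λ i → χ (i <? θ) * g i) ⟩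
  sumFin {θ} (λ k → χ (toℕ k <? θ) * g (toℕ k)) + sumFin {n ∸ θ} (λ k → χ (θ + toℕ k <? θ) * g (θ + toℕ k))
    ≡⟨ cong₂ _+_ (sum-cong (λ k → trans (cong (_* g (toℕ k)) (χ-yes (toℕ k <? θ) (toℕ<n k))) (+-identityʳ _)))
                 (sum-toℕ-const (n ∸ θ) (λ i → χ (θ + i <? θ) * g (θ + i)) 0
                    (λ i _ → cong (_* g (θ + i)) (χ-no (θ + i <? θ) (λ θ+i<θ → <-irrefl refl (≤-trans θ+i<θ (m≤m+n θ i)))))) ⟩
  sumFin {θ} (λ k → g (toℕ k)) + (n ∸ θ) * 0
    ≡⟨ cong (sumFin {θ} (λ k → g (toℕ k)) +_) (*-zeroʳ (n ∸ θ)) ⟩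
  sumFin {θ} (λ k → g (toℕ k)) + 0
    ≡⟨ +-identityʳ _ ⟩
  sumFin {θ} (λ k → g (toℕ k)) ∎
  where open ≡-Reasoning

-- The X-blocks of the construction

module Pattern (B : ℕ) .{{_ : NonZero B}} where

  e : ℕ → ℕ
  e i = (i / B) % 2

  e-01 : ∀ i → e i ≡ 0 ⊎ e i ≡ 1
  e-01 i with (i / B) % 2 | m%n<n (i / B) 2
  ... | 0 | _ = inj₁ refl
  ... | 1 | _ = inj₂ refl
  ... | suc (suc _) | s≤s (s≤s ())

  e-block : ∀ k j → j < B → e (k * B + j) ≡ k % 2
  e-block k j j<B = cong (_% 2) (begin
    (k * B + j) / B     ≡⟨ +-distrib-/-∣ˡ j (n∣m*n k) ⟩
    k * B / B + j / B   ≡⟨ cong₂ _+_ (m*n/n≡m k B) (m<n⇒m/n≡0 j<B) ⟩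
    k + 0               ≡⟨ +-identityʳ k ⟩
    k                   ∎)
    where open ≡-Reasoning

  e-even : ∀ i j → j < B → e (i * (2 * B) + j) ≡ 0
  e-even i j j<B = trans (cong (λ n → e (n + j)) (sym (*-assoc i 2 B))) (trans (e-block (i * 2) j j<B) (m*n%n≡0 i 2))

  e-odd : ∀ i j → j < B → e (i * (2 * B) + (B + j)) ≡ 1
  e-odd i j j<B = trans (cong e (reassoc B i j)) (trans (e-block (1 + i * 2) j j<B) ([m+kn]%n≡m%n 1 i 2))
    where reassoc : ∀ b i j → i * (2 * b) + (b + j) ≡ (1 + i * 2) * b + j
          reassoc = solve-∀

  sum-blocks : ∀ (h : ℕ → ℕ) j → sumFin {j * (2 * B)} (λ k → h (e (toℕ k))) ≡ j * (B * h 0 + B * h 1)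
  sum-blocks h zero = refl
  sum-blocks h (suc j) = begin
    sumFin {suc j * (2 * B)} (λ k → h (e (toℕ k)))
      ≡⟨ cong (λ n → sumFin {n} (λ k → h (e (toℕ k)))) (two-blocks B j) ⟩
    sumFin {j * (2 * B) + (B + B)} (λ k → h (e (toℕ k)))
      ≡⟨ sum-toℕ-+ (j * (2 * B)) (B + B) (λ i → h (e i)) ⟩
    sumFin {j * (2 * B)} (λ k → h (e (toℕ k))) + sumFin {B + B} (λ k → h (e (j * (2 * B) + toℕ k)))
      ≡⟨ cong₂ _+_ (sum-blocks h j) (sum-toℕ-+ B B (λ i → h (e (j * (2 * B) + i)))) ⟩
    j * (B * h 0 + B * h 1) + (sumFin {B} (λ k → h (e (j * (2 * B) + toℕ k))) + sumFin {B} (λ k → h (e (j * (2 * B) + (B + toℕ k)))))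
      ≡⟨ cong (j * (B * h 0 + B * h 1) +_) (cong₂ _+_
           (sum-toℕ-const B _ (h 0) (λ i i<B → cong h (e-even j i i<B)))
           (sum-toℕ-const B _ (h 1) (λ i i<B → cong h (e-odd j i i<B)))) ⟩
    j * (B * h 0 + B * h 1) + (B * h 0 + B * h 1)
      ≡⟨ +-comm (j * (B * h 0 + B * h 1)) _ ⟩
    suc j * (B * h 0 + B * h 1) ∎
    where
    open ≡-Reasoning
    two-blocks : ∀ b j → suc j * (2 * b) ≡ j * (2 * b) + (b + b)
    two-blocks = solve-∀

  weight-prefix : ∀ N j (h : ℕ → ℕ) → j * (2 * B) ≤ N →
    sumFin {N} (λ k → χ (toℕ k <? j * (2 * B)) * h (e (toℕ k))) ≡ j * (B * h 0 + B * h 1)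
  weight-prefix N j h θ≤N = trans (sum-toℕ-prefix N (j * (2 * B)) (λ i → h (e i)) θ≤N) (sum-blocks h j)

  weight-e : ∀ N j → j * (2 * B) ≤ N → sumFin {N} (λ k → χ (toℕ k <? j * (2 * B)) * e (toℕ k)) ≡ j * B
  weight-e N j θ≤N = trans (weight-prefix N j (λ x → x) θ≤N) (cong (j *_) (cong₂ _+_ (*-zeroʳ B) (*-identityʳ B)))

  weight-1∸e : ∀ N j → j * (2 * B) ≤ N → sumFin {N} (λ k → χ (toℕ k <? j * (2 * B)) * (1 ∸ e (toℕ k))) ≡ j * B
  weight-1∸e N j θ≤N = trans (weight-prefix N j (1 ∸_) θ≤N)
                             (cong (j *_) (trans (cong₂ _+_ (*-identityʳ B) (*-zeroʳ B)) (+-identityʳ B)))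

applyUpTo-cong : ∀ {A : Set} n {f g : ℕ → A} → (∀ i → i < n → f i ≡ g i) → applyUpTo f n ≡ applyUpTo g n
applyUpTo-cong zero    f≡g = refl
applyUpTo-cong (suc n) f≡g = cong₂ _∷_ (f≡g 0 z<s) (applyUpTo-cong n (λ i i<n → f≡g (suc i) (s<s i<n)))

applyUpTo-+ : ∀ {A : Set} m n (f : ℕ → A) → applyUpTo f (m + n) ≡ applyUpTo f m ++ applyUpTo (λ i → f (m + i)) n
applyUpTo-+ zero    n f = refl
applyUpTo-+ (suc m) n f = cong (f 0 ∷_) (applyUpTo-+ m n (λ i → f (suc i)))

concatMap-applyUpTo : ∀ {A : Set} (g : ℕ → List A) (h : ℕ → ℕ) L k (F : ℕ → A) →
  (∀ i → i < k → g (h i) ≡ applyUpTo (λ j → F (i * L + j)) L) →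
  concatMap g (applyUpTo h k) ≡ applyUpTo F (k * L)
concatMap-applyUpTo g h L zero    F blocks = refl
concatMap-applyUpTo g h L (suc k) F blocks = trans
  (cong₂ _++_ (blocks 0 z<s) (concatMap-applyUpTo g (λ i → h (suc i)) L k (λ i → F (L + i))
    (λ i i<k → trans (blocks (suc i) (s<s i<k)) (applyUpTo-cong L (λ j _ → cong F (+-assoc L (i * L) j))))))
  (sym (applyUpTo-+ L (k * L) F))

if-<ᵇ-yes : ∀ {A : Set} {i n} {x y : A} → i < n → (if i <ᵇ n then x else y) ≡ x
if-<ᵇ-yes {i = zero}  {suc n}       z<s       = refl
if-<ᵇ-yes {i = suc i} {suc (suc n)} (s<s i<n) = if-<ᵇ-yes {i = i} {suc n} i<n

if-<ᵇ-no : ∀ {A : Set} {i n} {x y : A} → n ≤ i → (if i <ᵇ n then x else y) ≡ y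
if-<ᵇ-no {i = i}     {zero}        _         = refl
if-<ᵇ-no {i = suc i} {suc zero}    _         = refl
if-<ᵇ-no {i = suc i} {suc (suc n)} (s≤s n≤i) = if-<ᵇ-no {i = i} {suc n} n≤i

∸-shift : ∀ {N P Q} c → N ≡ P + Q → Q ∸ c ≡ N ∸ (P + c)
∸-shift {N} {P} {Q} c refl = sym ([m+n]∸[m+o]≡n∸o P Q c)

module Construction (m′ B′ : ℕ) where

  m B N : ℕ
  m = suc m′
  B = suc B′
  N = 2 * m * B

  open Pattern B public

  xdeg : ℕ → ℕ × ℕ
  xdeg p = (p + e p , N ∸ (p + e p))

  xdeg≡ : ∀ p c → p + e p ≡ c → xdeg p ≡ (c , N ∸ c)
  xdeg≡ p c p+ep≡c = cong (λ c → (c , N ∸ c)) p+ep≡c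

  X₀-xdeg : X₀ m B ≡ applyUpTo xdeg B
  X₀-xdeg = trans (map-upTo _ B) (applyUpTo-cong B (λ j j<B →
    sym (xdeg≡ j j (trans (cong (j +_) (e-block 0 j j<B)) (+-identityʳ j)))))

  Xm-xdeg : Xm m B ≡ applyUpTo (λ j → xdeg (B + (m′ * (2 * B) + j))) B
  Xm-xdeg = trans (map-upTo _ B) (applyUpTo-cong B entry)
    where
    entry : ∀ j → j < B → ((2 * m ∸ 1) * B + j + 1 , B ∸ 1 ∸ j) ≡ xdeg (B + (m′ * (2 * B) + j))
    entry j j<B = sym (trans (xdeg≡ P c P+1≡c) (cong (c ,_) (sym rest)))
      where
      P : ℕ
      P = B + (m′ * (2 * B) + j)
      c : ℕ
      c = (2 * m ∸ 1) * B + j + 1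
      P+1≡c : P + e P ≡ c
      P+1≡c = trans (cong (P +_) (trans (cong e (ring₁ B m′ j)) (e-odd m′ j j<B))) (sym (ring₂ B m′ j))
        where ring₁ : ∀ b m j → b + (m * (2 * b) + j) ≡ m * (2 * b) + (b + j)
              ring₁ = solve-∀
              ring₂ : ∀ b m j → (m + suc (m + 0)) * b + j + 1 ≡ b + (m * (2 * b) + j) + 1
              ring₂ = solve-∀
      rest : B ∸ 1 ∸ j ≡ N ∸ c
      rest = trans (∸-+-assoc B 1 j) (trans (∸-shift {N} {B + m′ * (2 * B)} {B} (1 + j) (ring₁ B m′)) (cong (N ∸_) (ring₂ B m′ j)))
        where ring₁ : ∀ b m → 2 * suc m * b ≡ b + m * (2 * b) + b
              ring₁ = solve-∀
              ring₂ : ∀ b m j → b + m * (2 * b) + (1 + j) ≡ (m + suc (m + 0)) * b + j + 1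
              ring₂ = solve-∀

  -- The element function of Xi is local to its definition, so it is abstracted here as x.
  Xi-xdeg : ∀ i → i < m′ → (x : ℕ → ℕ × ℕ) →
    (∀ j → x j ≡ (if j <ᵇ B
                  then ((2 * suc i ∸ 1) * B + j + 1 , (2 * m ∸ 2 * suc i + 1) * B ∸ 1 ∸ j)
                  else ((2 * suc i ∸ 1) * B + j     , (2 * m ∸ 2 * suc i + 1) * B ∸ j))) →
    applyUpTo x (2 * B) ≡ applyUpTo (λ j → xdeg (B + (i * (2 * B) + j))) (2 * B)
  Xi-xdeg i i<m′ x x≡ = applyUpTo-cong (2 * B) entry
    where
    P₀ Q : ℕ
    P₀ = B + i * (2 * B)
    Q  = (2 * m ∸ 2 * suc i + 1) * B
    N≡P₀+Q : N ≡ P₀ + Q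
    N≡P₀+Q = trans (cong (λ k → 2 * suc k * B) m′≡) (trans (ring₁ i d B)
               (cong (λ k → P₀ + (k + 1) * B) (sym (trans (cong (λ k → 2 * suc k ∸ 2 * suc i) m′≡)
                 (trans (cong (_∸ 2 * suc i) (ring₂ i d)) (m+n∸m≡n (2 * suc i) (2 * suc d)))))))
      where
      d : ℕ
      d = m′ ∸ suc i
      m′≡ : m′ ≡ suc i + d
      m′≡ = sym (m+[n∸m]≡n i<m′)
      ring₁ : ∀ i d b → 2 * suc (suc i + d) * b ≡ b + i * (2 * b) + (2 * suc d + 1) * b
      ring₁ = solve-∀
      ring₂ : ∀ i d → 2 * suc (suc i + d) ≡ 2 * suc i + 2 * suc d
      ring₂ = solve-∀
    low : ∀ j → j < B → x j ≡ xdeg (B + (i * (2 * B) + j))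
    low j j<B = trans (x≡ j) (trans (if-<ᵇ-yes j<B) (sym (trans (xdeg≡ P c P+1≡c) (cong (c ,_) (sym rest)))))
      where
      P : ℕ
      P = B + (i * (2 * B) + j)
      c : ℕ
      c = (2 * suc i ∸ 1) * B + j + 1
      P+1≡c : P + e P ≡ c
      P+1≡c = trans (cong (P +_) (trans (cong e (ring₁ B i j)) (e-odd i j j<B))) (sym (ring₂ B i j))
        where ring₁ : ∀ b i j → b + (i * (2 * b) + j) ≡ i * (2 * b) + (b + j)
              ring₁ = solve-∀
              ring₂ : ∀ b i j → (i + suc (i + 0)) * b + j + 1 ≡ b + (i * (2 * b) + j) + 1
              ring₂ = solve-∀
      rest : Q ∸ 1 ∸ j ≡ N ∸ c
      rest = trans (∸-+-assoc Q 1 j) (trans (∸-shift {N} {P₀} {Q} (1 + j) N≡P₀+Q) (cong (N ∸_) (ring B i j)))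
        where ring : ∀ b i j → b + i * (2 * b) + (1 + j) ≡ (i + suc (i + 0)) * b + j + 1
              ring = solve-∀
    high : ∀ j → j < B → x (B + j) ≡ xdeg (B + (i * (2 * B) + (B + j)))
    high j j<B = trans (x≡ (B + j)) (trans (if-<ᵇ-no (m≤m+n B j)) (sym (trans (xdeg≡ P c P+0≡c) (cong (c ,_) (sym rest)))))
      where
      P : ℕ
      P = B + (i * (2 * B) + (B + j))
      c : ℕ
      c = (2 * suc i ∸ 1) * B + (B + j)
      P+0≡c : P + e P ≡ c
      P+0≡c = trans (cong (P +_) (trans (cong e (ring₁ B i j)) (e-even (suc i) j j<B))) (sym (ring₂ B i j))
        where ring₁ : ∀ b i j → b + (i * (2 * b) + (b + j)) ≡ suc i * (2 * b) + j
              ring₁ = solve-∀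
              ring₂ : ∀ b i j → (i + suc (i + 0)) * b + (b + j) ≡ b + (i * (2 * b) + (b + j)) + 0
              ring₂ = solve-∀
      rest : Q ∸ (B + j) ≡ N ∸ c
      rest = trans (∸-shift {N} {P₀} {Q} (B + j) N≡P₀+Q) (cong (N ∸_) (ring B i j))
        where ring : ∀ b i j → b + i * (2 * b) + (b + j) ≡ (i + suc (i + 0)) * b + (b + j)
              ring = solve-∀
    entry : ∀ j → j < 2 * B → x j ≡ xdeg (B + (i * (2 * B) + j))
    entry j j<2B with j <? B
    ... | yes j<B = low j j<B
    ... | no j≮B  = subst (λ j → x j ≡ xdeg (B + (i * (2 * B) + j))) (m+[n∸m]≡n (≮⇒≥ j≮B))
                      (high (j ∸ B) (m<n+o⇒m∸n<o j B (subst (j <_) (cong (B +_) (+-identityʳ B)) j<2B)))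

  X-xdeg : X₀ m B ++ Xmid m B ++ Xm m B ≡ applyUpTo xdeg N
  X-xdeg = begin
    X₀ m B ++ Xmid m B ++ Xm m B
      ≡⟨ cong₂ _++_ X₀-xdeg (cong₂ _++_ Xmid-xdeg Xm-xdeg) ⟩
    applyUpTo xdeg B ++ applyUpTo (λ i → xdeg (B + i)) (m′ * (2 * B)) ++ applyUpTo (λ i → xdeg (B + (m′ * (2 * B) + i))) B
      ≡⟨ cong (applyUpTo xdeg B ++_) (applyUpTo-+ (m′ * (2 * B)) B (λ i → xdeg (B + i))) ⟨
    applyUpTo xdeg B ++ applyUpTo (λ i → xdeg (B + i)) (m′ * (2 * B) + B)
      ≡⟨ applyUpTo-+ B (m′ * (2 * B) + B) xdeg ⟨
    applyUpTo xdeg (B + (m′ * (2 * B) + B))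
      ≡⟨ cong (applyUpTo xdeg) (ring m′ B) ⟩
    applyUpTo xdeg N ∎
    where
    open ≡-Reasoning
    ring : ∀ m b → b + (m * (2 * b) + b) ≡ 2 * suc m * b
    ring = solve-∀
    Xmid-xdeg : Xmid m B ≡ applyUpTo (λ i → xdeg (B + i)) (m′ * (2 * B))
    Xmid-xdeg = trans (cong (concatMap (Xi m B)) (map-upTo suc m′))
      (concatMap-applyUpTo (Xi m B) suc (2 * B) m′ (λ i → xdeg (B + i))
        (λ i i<m′ → trans (map-upTo _ (2 * B)) (Xi-xdeg i i<m′ _ (λ j → refl))))

-- Structure of a realization

-- A i is the vertex of α_i and X p the p-th vertex of X₀ ∪ … ∪ X_m.
module Realization (K N : ℕ) (a : Fin K → ℕ) (e : ℕ → ℕ) (e01 : ∀ i → e i ≡ 0 ⊎ e i ≡ 1)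
  (E : Digraph (K + N)) (dag : IsDag E)
  (deg-A : ∀ i → indeg E (i ↑ˡ N) ≡ a i × outdeg E (i ↑ˡ N) ≡ a i)
  (deg-X : ∀ p → indeg E (K ↑ʳ p) ≡ toℕ p + e (toℕ p) × outdeg E (K ↑ʳ p) ≡ N ∸ (toℕ p + e (toℕ p)))
  (sum-a : 2 * sumFin a ≡ N) where

  V : Set
  V = Fin (K + N)

  A : Fin K → V
  A i = i ↑ˡ N

  X : Fin N → V
  X p = K ↑ʳ p

  [_⇒_] : V → V → ℕ
  [ u ⇒ v ] = ind (E u v)

  no-loop : ∀ u → ¬ Arc E u u
  no-loop = proj₁ dag

  no-2-cycle : ∀ u v → Arc E u v → ¬ Arc E v u
  no-2-cycle u v uv vu = proj₂ dag u (uv ∷ [ vu ])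

  no-3-cycle : ∀ u v w → Arc E u v → Arc E v w → ¬ Arc E w u
  no-3-cycle u v w uv vw wu = proj₂ dag u (uv ∷ vw ∷ [ wu ])

  ⇒+⇐≤1 : ∀ u v → [ u ⇒ v ] + [ v ⇒ u ] ≤ 1
  ⇒+⇐≤1 u v with E u v in uv | E v u in vu
  ... | true  | true  = ⊥-elim (no-2-cycle u v uv vu)
  ... | true  | false = ≤-refl
  ... | false | true  = ≤-refl
  ... | false | false = z≤n

  inᴬ inˣ outᴬ outˣ : V → ℕ
  inᴬ  u = sumFin (λ i → [ A i ⇒ u ])
  inˣ  u = sumFin (λ p → [ X p ⇒ u ])
  outᴬ u = sumFin (λ i → [ u ⇒ A i ])
  outˣ u = sumFin (λ p → [ u ⇒ X p ])

  indeg-split : ∀ u → indeg E u ≡ inᴬ u + inˣ u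
  indeg-split u = sum-++ K (λ w → [ w ⇒ u ])

  outdeg-split : ∀ u → outdeg E u ≡ outᴬ u + outˣ u
  outdeg-split u = sum-++ K (λ w → [ u ⇒ w ])

  degˣ degᴬ : Fin N → ℕ
  degˣ p = inˣ (X p) + outˣ (X p)
  degᴬ p = inᴬ (X p) + outᴬ (X p)

  degˣ-as-sum : ∀ p → degˣ p ≡ sumFin (λ q → [ X q ⇒ X p ] + [ X p ⇒ X q ])
  degˣ-as-sum p = sym (sum-+ (λ q → [ X q ⇒ X p ]) (λ q → [ X p ⇒ X q ]))

  X-pair≤1 : ∀ p q → [ X q ⇒ X p ] + [ X p ⇒ X q ] + χ (q ≟ᶠ p) ≤ 1
  X-pair≤1 p q with q ≟ᶠ p
  ... | no _ = ≤-trans (≤-reflexive (+-identityʳ _)) (⇒+⇐≤1 (X q) (X p))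
  ... | yes refl with E (X q) (X q) in qq
  ...   | true  = ⊥-elim (no-loop (X q) qq)
  ...   | false = ≤-refl

  X-pairs-sum : ∀ p → sumFin (λ q → [ X q ⇒ X p ] + [ X p ⇒ X q ] + χ (q ≟ᶠ p)) ≡ suc (degˣ p)
  X-pairs-sum p = begin
    sumFin (λ q → [ X q ⇒ X p ] + [ X p ⇒ X q ] + χ (q ≟ᶠ p))                  ≡⟨ sum-+ (λ q → [ X q ⇒ X p ] + [ X p ⇒ X q ]) _ ⟩
    sumFin (λ q → [ X q ⇒ X p ] + [ X p ⇒ X q ]) + sumFin (λ q → χ (q ≟ᶠ p))   ≡⟨ cong₂ _+_ (sym (degˣ-as-sum p)) (sum-δ p) ⟩
    degˣ p + 1                                                                ≡⟨ +-comm (degˣ p) 1 ⟩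
    suc (degˣ p)                                                              ∎
    where open ≡-Reasoning

  degˣ<N : ∀ p → degˣ p < N
  degˣ<N p = ≤-trans (≤-reflexive (sym (X-pairs-sum p))) (≤-trans (sum-mono-≤ (X-pair≤1 p)) (≤-reflexive sum-1))

  +e≤N : ∀ p → p < N → p + e p ≤ N
  +e≤N p p<N with e01 p
  ... | inj₁ ep≡0 = ≤-trans (≤-reflexive (trans (cong (p +_) ep≡0) (+-identityʳ p))) (<⇒≤ p<N)
  ... | inj₂ ep≡1 = ≤-trans (≤-reflexive (trans (cong (p +_) ep≡1) (+-comm p 1))) p<N

  degˣ+degᴬ : ∀ p → degˣ p + degᴬ p ≡ N
  degˣ+degᴬ p = begin
    degˣ p + degᴬ p                                       ≡⟨ interchange (inˣ (X p)) (outˣ (X p)) (inᴬ (X p)) (outᴬ (X p)) ⟩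
    inˣ (X p) + inᴬ (X p) + (outˣ (X p) + outᴬ (X p))     ≡⟨ cong₂ _+_ (+-comm (inˣ (X p)) _) (+-comm (outˣ (X p)) _) ⟩
    inᴬ (X p) + inˣ (X p) + (outᴬ (X p) + outˣ (X p))     ≡⟨ sym (cong₂ _+_ (indeg-split (X p)) (outdeg-split (X p))) ⟩
    indeg E (X p) + outdeg E (X p)                        ≡⟨ cong₂ _+_ (proj₁ (deg-X p)) (proj₂ (deg-X p)) ⟩
    toℕ p + e (toℕ p) + (N ∸ (toℕ p + e (toℕ p)))         ≡⟨ m+[n∸m]≡n (+e≤N (toℕ p) (toℕ<n p)) ⟩
    N                                                     ∎
    where open ≡-Reasoning

  degᴬ-sum-by-A : sumFin degᴬ ≡ sumFin (λ i → inˣ (A i) + outˣ (A i))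
  degᴬ-sum-by-A = begin
    sumFin degᴬ                                                  ≡⟨ sum-cong (λ p → sym (sum-+ (λ i → [ A i ⇒ X p ]) _)) ⟩
    sumFin (λ p → sumFin (λ i → [ A i ⇒ X p ] + [ X p ⇒ A i ])) ≡⟨ sum-comm {N} {K} (λ p i → [ A i ⇒ X p ] + [ X p ⇒ A i ]) ⟩
    sumFin (λ i → sumFin (λ p → [ A i ⇒ X p ] + [ X p ⇒ A i ]))
      ≡⟨ sum-cong (λ i → trans (sum-+ (λ p → [ A i ⇒ X p ]) _) (+-comm (outˣ (A i)) _)) ⟩
    sumFin (λ i → inˣ (A i) + outˣ (A i))                        ∎
    where open ≡-Reasoning

  inˣ-A≤ : ∀ i → inˣ (A i) ≤ a i
  inˣ-A≤ i = ≤-trans (m≤n+m (inˣ (A i)) (inᴬ (A i))) (≤-reflexive (trans (sym (indeg-split (A i))) (proj₁ (deg-A i))))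

  outˣ-A≤ : ∀ i → outˣ (A i) ≤ a i
  outˣ-A≤ i = ≤-trans (m≤n+m (outˣ (A i)) (outᴬ (A i))) (≤-reflexive (trans (sym (outdeg-split (A i))) (proj₂ (deg-A i))))

  sum-a+a : sumFin (λ i → a i + a i) ≡ N
  sum-a+a = trans (sum-+ a a) (trans (cong (sumFin a +_) (sym (+-identityʳ (sumFin a)))) sum-a)

  sum-degᴬ≤N : sumFin degᴬ ≤ N
  sum-degᴬ≤N = begin
    sumFin degᴬ                             ≡⟨ degᴬ-sum-by-A ⟩
    sumFin (λ i → inˣ (A i) + outˣ (A i))   ≤⟨ sum-mono-≤ (λ i → +-mono-≤ (inˣ-A≤ i) (outˣ-A≤ i)) ⟩
    sumFin (λ i → a i + a i)                ≡⟨ sum-a+a ⟩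
    N                                       ∎
    where open ≤-Reasoning

  sum-degˣ+sum-degᴬ : sumFin degˣ + sumFin degᴬ ≡ N * N
  sum-degˣ+sum-degᴬ = trans (sym (sum-+ degˣ degᴬ)) (trans (sum-cong degˣ+degᴬ) (sum-const {N} N))

  sum-degˣ+N≤N*N : sumFin degˣ + N ≤ N * N
  sum-degˣ+N≤N*N = begin
    sumFin degˣ + N                    ≡⟨ cong (sumFin degˣ +_) (sym sum-1) ⟩
    sumFin degˣ + sumFin {N} (λ _ → 1) ≡⟨ sym (sum-+ degˣ (λ _ → 1)) ⟩
    sumFin (λ p → degˣ p + 1)          ≤⟨ sum-mono-≤ (λ p → ≤-trans (≤-reflexive (+-comm (degˣ p) 1)) (degˣ<N p)) ⟩
    sumFin {N} (λ _ → N)               ≡⟨ sum-const {N} N ⟩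
    N * N                              ∎
    where open ≤-Reasoning

  -- Both estimates are tight: their sum is the total degree of X.
  sum-degᴬ≡N : sumFin degᴬ ≡ N
  sum-degᴬ≡N = ≤-antisym sum-degᴬ≤N
    (+-cancelˡ-≤ (sumFin degˣ) _ _ (≤-trans sum-degˣ+N≤N*N (≤-reflexive (sym sum-degˣ+sum-degᴬ))))

  suc-degˣ≡N : ∀ p → suc (degˣ p) ≡ N
  suc-degˣ≡N = sum-≡⇒≡ degˣ<N (begin
    sumFin (λ p → suc (degˣ p))        ≡⟨ sum-+ (λ _ → 1) degˣ ⟩
    sumFin {N} (λ _ → 1) + sumFin degˣ ≡⟨ cong (_+ sumFin degˣ) sum-1 ⟩
    N + sumFin degˣ                    ≡⟨ +-comm N _ ⟩
    sumFin degˣ + N                    ≡⟨ cong (sumFin degˣ +_) (sym sum-degᴬ≡N) ⟩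
    sumFin degˣ + sumFin degᴬ          ≡⟨ sum-degˣ+sum-degᴬ ⟩
    N * N                              ≡⟨ sum-const {N} N ⟨
    sumFin {N} (λ _ → N)               ∎)
    where open ≡-Reasoning

  degᴬ≡1 : ∀ p → degᴬ p ≡ 1
  degᴬ≡1 p = +-cancelˡ-≡ (degˣ p) _ _ (trans (degˣ+degᴬ p) (trans (sym (suc-degˣ≡N p)) (+-comm 1 (degˣ p))))

  degˣ-A : ∀ i → inˣ (A i) + outˣ (A i) ≡ a i + a i
  degˣ-A = sum-≡⇒≡ (λ i → +-mono-≤ (inˣ-A≤ i) (outˣ-A≤ i))
                   (trans (sym degᴬ-sum-by-A) (trans sum-degᴬ≡N (sym sum-a+a)))

  inˣ-A : ∀ i → inˣ (A i) ≡ a i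
  inˣ-A i = ≤-antisym (inˣ-A≤ i)
    (+-cancelʳ-≤ (outˣ (A i)) _ _ (≤-trans (+-monoʳ-≤ (a i) (outˣ-A≤ i)) (≤-reflexive (sym (degˣ-A i)))))

  outˣ-A : ∀ i → outˣ (A i) ≡ a i
  outˣ-A i = +-cancelˡ-≡ (a i) _ _ (trans (cong (_+ outˣ (A i)) (sym (inˣ-A i))) (degˣ-A i))

  X-pair≡1 : ∀ p q → q ≢ p → [ X q ⇒ X p ] + [ X p ⇒ X q ] ≡ 1
  X-pair≡1 p q q≢p = begin
    [ X q ⇒ X p ] + [ X p ⇒ X q ]                 ≡⟨ +-identityʳ _ ⟨
    [ X q ⇒ X p ] + [ X p ⇒ X q ] + 0             ≡⟨ cong ([ X q ⇒ X p ] + [ X p ⇒ X q ] +_) (χ-no (q ≟ᶠ p) q≢p) ⟨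
    [ X q ⇒ X p ] + [ X p ⇒ X q ] + χ (q ≟ᶠ p)
      ≡⟨ sum-≡⇒≡ (X-pair≤1 p) (trans (X-pairs-sum p) (trans (suc-degˣ≡N p) (sym sum-1))) q ⟩
    1                                             ∎
    where open ≡-Reasoning

  X-tournament : ∀ p q → q ≢ p → Arc E (X q) (X p) ⊎ Arc E (X p) (X q)
  X-tournament p q q≢p with E (X q) (X p) | E (X p) (X q) | X-pair≡1 p q q≢p
  ... | true  | _     | _ = inj₁ refl
  ... | false | true  | _ = inj₂ refl
  ... | false | false | ()

  rank : Fin N → ℕ
  rank p = inˣ (X p)

  -- An acyclic tournament is transitive.
  rank-< : ∀ p q → Arc E (X p) (X q) → rank p < rank q
  rank-< p q pq = begin
    suc (rank p)                                ≡⟨ trans (+-comm 1 (rank p)) (cong (rank p +_) (sym (sum-δ p))) ⟩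
    rank p + sumFin (λ w → χ (w ≟ᶠ p))          ≡⟨ sum-+ (λ w → [ X w ⇒ X p ]) (λ w → χ (w ≟ᶠ p)) ⟨
    sumFin (λ w → [ X w ⇒ X p ] + χ (w ≟ᶠ p))   ≤⟨ sum-mono-≤ into-q ⟩
    rank q                                      ∎
    where
    open ≤-Reasoning
    into-q : ∀ w → [ X w ⇒ X p ] + χ (w ≟ᶠ p) ≤ [ X w ⇒ X q ]
    into-q w with w ≟ᶠ p
    ... | yes refl with E (X w) (X w) in ww
    ...   | true  = ⊥-elim (no-loop (X w) ww)
    ...   | false = ≤-reflexive (sym (cong ind pq))
    into-q w | no _ with E (X w) (X p) in wp
    ... | false = z≤n
    ... | true with w ≟ᶠ q
    ...   | yes refl = ⊥-elim (no-2-cycle (X p) (X w) pq wp)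
    ...   | no w≢q with X-tournament q w w≢q
    ...     | inj₁ wq = ≤-reflexive (sym (cong ind wq))
    ...     | inj₂ qw = ⊥-elim (no-3-cycle (X p) (X q) (X w) pq qw wp)

  rank-injective : Injective _≡_ _≡_ rank
  rank-injective {p} {q} rp≡rq with q ≟ᶠ p
  ... | yes q≡p = sym q≡p
  ... | no q≢p with X-tournament p q q≢p
  ...   | inj₁ qp = ⊥-elim (<-irrefl (sym rp≡rq) (rank-< q p qp))
  ...   | inj₂ pq = ⊥-elim (<-irrefl rp≡rq (rank-< p q pq))

  rank<N : ∀ p → rank p < N
  rank<N p = ≤-trans (s≤s (m≤m+n (rank p) (outˣ (X p)))) (degˣ<N p)

  +e≤suc : ∀ i → i + e i ≤ suc i
  +e≤suc i with e01 i
  ... | inj₁ ei≡0 = ≤-trans (≤-reflexive (trans (cong (i +_) ei≡0) (+-identityʳ i))) (n≤1+n i)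
  ... | inj₂ ei≡1 = ≤-reflexive (trans (cong (i +_) ei≡1) (+-comm i 1))

  count-indeg-≤ : ∀ t s → s ≤ N → (∀ i → i < s → i + e i ≤ t) → (∀ i → s ≤ i → t < i + e i) →
    sumFin (λ q → χ (indeg E (X q) ≤? t)) ≡ s
  count-indeg-≤ t s s≤N below above = trans (sum-cong (λ q → cong (λ d → χ (d ≤? t)) (proj₁ (deg-X q))))
                                            (count-≤-threshold N (λ i → i + e i) t s s≤N below above)

  inᴬ-X≤1 : ∀ p → inᴬ (X p) ≤ 1
  inᴬ-X≤1 p = ≤-trans (m≤m+n _ (outᴬ (X p))) (≤-reflexive (degᴬ≡1 p))

  -- indeg (X q) = inᴬ (X q) + rank q with inᴬ (X q) ≤ 1, while the prescribed indegrees
  -- i + e i determine how many X-vertices have indegree ≤ t. Taking t = rank p, this count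
  -- equals the number of ranks ≤ t (if e t = 0) or < t (if e t = 1), which decides for X p.
  inᴬ-X : ∀ p → inᴬ (X p) ≡ e (rank p)
  inᴬ-X p with e01 (rank p)
  ... | inj₁ et≡0 = trans inᴬ≡0 (sym et≡0)
    where
    t : ℕ
    t = rank p
    below : ∀ i → i < suc t → i + e i ≤ t
    below i (s≤s i≤t) with m≤n⇒m<n∨m≡n i≤t
    ... | inj₁ i<t  = ≤-trans (+e≤suc i) i<t
    ... | inj₂ refl = ≤-reflexive (trans (cong (i +_) et≡0) (+-identityʳ i))
    above : ∀ i → suc t ≤ i → t < i + e i
    above i t<i = ≤-trans t<i (m≤m+n i (e i))
    ≤-rank : ∀ q → χ (indeg E (X q) ≤? t) ≤ χ (rank q <? suc t)
    ≤-rank q with indeg E (X q) ≤? t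
    ... | no _    = z≤n
    ... | yes d≤t = ≤-reflexive (sym (χ-yes (rank q <? suc t)
                      (s≤s (≤-trans (m≤n+m (rank q) _) (≤-trans (≤-reflexive (sym (indeg-split (X q)))) d≤t)))))
    same : χ (indeg E (X p) ≤? t) ≡ χ (rank p <? suc t)
    same = sum-≡⇒≡ ≤-rank (trans (count-indeg-≤ t (suc t) (rank<N p) below above)
                                 (sym (count-< rank rank-injective rank<N (suc t) (rank<N p)))) p
    inᴬ≡0 : inᴬ (X p) ≡ 0
    inᴬ≡0 = n≤0⇒n≡0 (+-cancelʳ-≤ t _ 0 (≤-trans (≤-reflexive (sym (indeg-split (X p))))
              (χ>0⇒ (indeg E (X p) ≤? t) (≤-reflexive (sym (trans same (χ-yes (rank p <? suc t) ≤-refl)))))))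
  ... | inj₂ et≡1 = trans inᴬ≡1 (sym et≡1)
    where
    t : ℕ
    t = rank p
    below : ∀ i → i < t → i + e i ≤ t
    below i i<t = ≤-trans (+e≤suc i) i<t
    above : ∀ i → t ≤ i → t < i + e i
    above i t≤i with m≤n⇒m<n∨m≡n t≤i
    ... | inj₁ t<i  = ≤-trans t<i (m≤m+n i (e i))
    ... | inj₂ refl = ≤-reflexive (trans (+-comm 1 t) (cong (t +_) (sym et≡1)))
    rank-≤ : ∀ q → χ (rank q <? t) ≤ χ (indeg E (X q) ≤? t)
    rank-≤ q with rank q <? t
    ... | no _    = z≤n
    ... | yes r<t = ≤-reflexive (sym (χ-yes (indeg E (X q) ≤? t)
                      (≤-trans (≤-reflexive (indeg-split (X q))) (≤-trans (+-monoˡ-≤ (rank q) (inᴬ-X≤1 q)) r<t))))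
    same : χ (rank p <? t) ≡ χ (indeg E (X p) ≤? t)
    same = sum-≡⇒≡ rank-≤ (trans (count-< rank rank-injective rank<N t (<⇒≤ (rank<N p)))
                                 (sym (count-indeg-≤ t t (<⇒≤ (rank<N p)) below above))) p
    indeg>t : ¬ indeg E (X p) ≤ t
    indeg>t = χ≡0⇒ (indeg E (X p) ≤? t) (trans (sym same) (χ-no (rank p <? t) (<-irrefl refl)))
    inᴬ≡1 : inᴬ (X p) ≡ 1
    inᴬ≡1 with inᴬ (X p) | inᴬ-X≤1 p | indeg-split (X p)
    ... | 0 | _     | split = ⊥-elim (indeg>t (≤-reflexive split))
    ... | 1 | _     | _     = refl
    ... | suc (suc _) | s≤s () | _

  outᴬ-X : ∀ p → outᴬ (X p) ≡ 1 ∸ e (rank p)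
  outᴬ-X p = trans (sym (m+n∸m≡n (inᴬ (X p)) (outᴬ (X p)))) (cong₂ _∸_ (degᴬ≡1 p) (inᴬ-X p))

  out-cut in-cut : ℕ → Fin K → ℕ
  out-cut θ i = sumFin (λ p → [ A i ⇒ X p ] * χ (rank p <? θ))
  in-cut  θ i = sumFin (λ p → [ X p ⇒ A i ] * χ (rank p <? θ))

  reaches-below : ℕ → Fin K → Bool
  reaches-below θ i = 0 <ᵇ out-cut θ i

  sum-cut : ∀ θ (arc : Fin K → Fin N → ℕ) (h : ℕ → ℕ) → (∀ p → sumFin (λ i → arc i p) ≡ h (rank p)) →
    sumFin (λ i → sumFin (λ p → arc i p * χ (rank p <? θ))) ≡ sumFin {N} (λ k → χ (toℕ k <? θ) * h (toℕ k))
  sum-cut θ arc h arcs = begin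
    sumFin (λ i → sumFin (λ p → arc i p * χ (rank p <? θ)))   ≡⟨ sum-comm {K} {N} (λ i p → arc i p * χ (rank p <? θ)) ⟩
    sumFin (λ p → sumFin (λ i → arc i p * χ (rank p <? θ)))   ≡⟨ sum-cong (λ p → sum-*ʳ (χ (rank p <? θ)) (λ i → arc i p)) ⟩
    sumFin (λ p → sumFin (λ i → arc i p) * χ (rank p <? θ))
      ≡⟨ sum-cong (λ p → trans (cong (_* χ (rank p <? θ)) (arcs p)) (*-comm (h (rank p)) _)) ⟩
    sumFin (λ p → χ (rank p <? θ) * h (rank p))               ≡⟨ sum-reindex rank rank-injective rank<N (λ k → χ (k <? θ) * h k) ⟩
    sumFin {N} (λ k → χ (toℕ k <? θ) * h (toℕ k))             ∎
    where open ≡-Reasoning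

  out-cut≤ : ∀ θ i → out-cut θ i ≤ ind (reaches-below θ i) * a i
  out-cut≤ θ i with out-cut θ i in cut≡
  ... | zero  = z≤n
  ... | suc _ = ≤-trans (≤-reflexive (sym cut≡)) (≤-trans (sum-mono-≤ (λ p → *χ≤ [ A i ⇒ X p ] (rank p <? θ)))
                            (≤-reflexive (trans (outˣ-A i) (sym (+-identityʳ (a i))))))
    where *χ≤ : ∀ x {P : Set} (d : Dec P) → x * χ d ≤ x
          *χ≤ x d = ≤-trans (*-monoʳ-≤ x (χ≤1 d)) (≤-reflexive (*-identityʳ x))

  -- An A-vertex with an out-arc to some X p of rank below θ receives all its in-arcs
  -- from X-vertices of rank below rank p, by acyclicity and transitivity of the tournament.
  ≤in-cut : ∀ θ i → ind (reaches-below θ i) * a i ≤ in-cut θ i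
  ≤in-cut θ i with out-cut θ i in cut≡
  ... | zero  = z≤n
  ... | suc _ with sum>0⇒∃ (λ p → [ A i ⇒ X p ] * χ (rank p <? θ)) (subst (0 <_) (sym cut≡) z<s)
  ...   | p , 0<term with E (A i) (X p) in ip | rank p <? θ
  ...     | true | yes rp<θ = ≤-reflexive (trans (+-identityʳ (a i)) (trans (sym (inˣ-A i)) (sum-cong all-below)))
    where
    rank-below : ∀ q → Arc E (X q) (A i) → rank q < rank p
    rank-below q qi with q ≟ᶠ p
    ... | yes refl = ⊥-elim (no-2-cycle (X q) (A i) qi ip)
    ... | no q≢p with X-tournament p q q≢p
    ...   | inj₁ qp = rank-< q p qp
    ...   | inj₂ pq = ⊥-elim (no-3-cycle (X q) (A i) (X p) qi ip pq)
    all-below : ∀ q → [ X q ⇒ A i ] ≡ [ X q ⇒ A i ] * χ (rank q <? θ)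
    all-below q with E (X q) (A i) in qi
    ... | false = refl
    ... | true  = sym (cong (_+ 0) (χ-yes (rank q <? θ) (<-trans (rank-below q qi) rp<θ)))

  weight-reaches-below : ∀ θ →
    sumFin {N} (λ k → χ (toℕ k <? θ) * e (toℕ k)) ≡ sumFin {N} (λ k → χ (toℕ k <? θ) * (1 ∸ e (toℕ k))) →
    sumFin (λ i → ind (reaches-below θ i) * a i) ≡ sumFin {N} (λ k → χ (toℕ k <? θ) * e (toℕ k))
  weight-reaches-below θ balanced = ≤-antisym
    (≤-trans (sum-mono-≤ (≤in-cut θ)) (≤-reflexive (trans (sum-cut θ (λ i p → [ X p ⇒ A i ]) (λ k → 1 ∸ e k) (outᴬ-X))
                                                          (sym balanced))))
    (≤-trans (≤-reflexive (sym (sum-cut θ (λ i p → [ A i ⇒ X p ]) e inᴬ-X))) (sum-mono-≤ (out-cut≤ θ)))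

  out-cut-mono : ∀ {θ θ′} i → θ ≤ θ′ → out-cut θ i ≤ out-cut θ′ i
  out-cut-mono {θ} {θ′} i θ≤θ′ = sum-mono-≤ (λ p → *-monoʳ-≤ [ A i ⇒ X p ] (χ-mono (rank p)))
    where χ-mono : ∀ r → χ (r <? θ) ≤ χ (r <? θ′)
          χ-mono r with r <? θ | r <? θ′
          ... | no _    | _       = z≤n
          ... | yes _   | yes _   = ≤-refl
          ... | yes r<θ | no r≮θ′ = ⊥-elim (r≮θ′ (<-≤-trans r<θ θ≤θ′))

  reaches-below-mono : ∀ {θ θ′} i → θ ≤ θ′ → reaches-below θ i ≡ true → reaches-below θ′ i ≡ true
  reaches-below-mono i θ≤θ′ reaches = 0<⇒0<ᵇ (<-≤-trans (0<ᵇ⇒0< reaches) (out-cut-mono i θ≤θ′))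

  ¬reaches-below-0 : ∀ i → reaches-below 0 i ≡ false
  ¬reaches-below-0 i = cong (0 <ᵇ_) (trans (sum-cong (λ p → *-zeroʳ [ A i ⇒ X p ])) (sum-0 {N}))

  reaches-below-N : ∀ {θ} i → N ≤ θ → 0 < a i → reaches-below θ i ≡ true
  reaches-below-N {θ} i N≤θ 0<ai = 0<⇒0<ᵇ (<-≤-trans 0<ai (≤-reflexive (sym (trans (sum-cong all) (outˣ-A i)))))
    where all : ∀ p → [ A i ⇒ X p ] * χ (rank p <? θ) ≡ [ A i ⇒ X p ]
          all p = trans (cong ([ A i ⇒ X p ] *_) (χ-yes (rank p <? θ) (<-≤-trans (rank<N p) N≤θ))) (*-identityʳ _)

-- From the cuts to the triples

∃-step : ∀ m (b : ℕ → Bool) → b 0 ≡ false → b m ≡ true → Σ (Fin m) λ k → b (toℕ k) ≡ false × b (suc (toℕ k)) ≡ true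
∃-step zero    b b0 bm with () ← trans (sym bm) b0
∃-step (suc m) b b0 bm with b 1 in b1
... | true  = fzero , b0 , b1
... | false = let (k , bk , bk+1) = ∃-step m (λ j → b (suc j)) b1 bm in fsuc k , bk , bk+1

step-unique : (b : ℕ → Bool) → (∀ {j j′} → j ≤ j′ → b j ≡ true → b j′ ≡ true) →
  ∀ {k k′} → b k ≡ false → b (suc k) ≡ true → b k′ ≡ false → b (suc k′) ≡ true → k ≡ k′
step-unique b mono {k} {k′} bk bk+1 bk′ bk′+1 with <-cmp k k′
... | tri< k<k′ _ _ with () ← trans (sym (mono k<k′ bk+1)) bk′
... | tri≈ _ k≡k′ _ = k≡k′
... | tri> _ _ k′<k with () ← trans (sym (mono k′<k bk′+1)) bk

module Levels {K : ℕ} (m B : ℕ) (a : Fin K → ℕ) (S : ℕ → Fin K → Bool)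
  (S-mono : ∀ {j j′} v → j ≤ j′ → S j v ≡ true → S j′ v ≡ true)
  (S-0 : ∀ v → S 0 v ≡ false) (S-m : ∀ v → S m v ≡ true)
  (S-weight : ∀ j → j ≤ m → sumFin (λ v → ind (S j v) * a v) ≡ j * B) where

  level : Fin K → Fin m
  level v = proj₁ (∃-step m (λ j → S j v) (S-0 v) (S-m v))

  level-step : ∀ v → S (toℕ (level v)) v ≡ false × S (suc (toℕ (level v))) v ≡ true
  level-step v = proj₂ (∃-step m (λ j → S j v) (S-0 v) (S-m v))

  ind-S-suc : ∀ (k : Fin m) v → ind (S (suc (toℕ k)) v) ≡ ind (S (toℕ k) v) + χ (level v ≟ᶠ k)
  ind-S-suc k v with S (toℕ k) v in Sk | S (suc (toℕ k)) v in Sk+1 | level v ≟ᶠ k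
  ... | true  | true  | no _     = refl
  ... | true  | true  | yes refl with () ← trans (sym Sk) (proj₁ (level-step v))
  ... | true  | false | _        with () ← trans (sym (S-mono v (n≤1+n _) Sk)) Sk+1
  ... | false | true  | yes _    = refl
  ... | false | true  | no lv≢k  = ⊥-elim (lv≢k (toℕ-injective
          (step-unique (λ j → S j v) (S-mono v) (proj₁ (level-step v)) (proj₂ (level-step v)) Sk Sk+1)))
  ... | false | false | no _     = refl
  ... | false | false | yes refl with () ← trans (sym (proj₂ (level-step v))) Sk+1

  level-weight : ∀ (k : Fin m) → sumFin (λ v → χ (level v ≟ᶠ k) * a v) ≡ B
  level-weight k = +-cancelˡ-≡ (toℕ k * B) _ _ (begin
    toℕ k * B + sumFin (λ v → χ (level v ≟ᶠ k) * a v)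
      ≡⟨ cong (_+ sumFin (λ v → χ (level v ≟ᶠ k) * a v)) (S-weight (toℕ k) (<⇒≤ (toℕ<n k))) ⟨
    sumFin (λ v → ind (S (toℕ k) v) * a v) + sumFin (λ v → χ (level v ≟ᶠ k) * a v)
      ≡⟨ sum-+ (λ v → ind (S (toℕ k) v) * a v) (λ v → χ (level v ≟ᶠ k) * a v) ⟨
    sumFin (λ v → ind (S (toℕ k) v) * a v + χ (level v ≟ᶠ k) * a v)
      ≡⟨ sum-cong (λ v → trans (sym (*-distribʳ-+ (a v) (ind (S (toℕ k) v)) _)) (cong (_* a v) (sym (ind-S-suc k v)))) ⟩
    sumFin (λ v → ind (S (suc (toℕ k)) v) * a v)
      ≡⟨ S-weight (suc (toℕ k)) (toℕ<n k) ⟩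
    B + toℕ k * B
      ≡⟨ +-comm B _ ⟩
    toℕ k * B + B ∎)
    where open ≡-Reasoning

χ-× : {P Q R : Set} (p : Dec P) (q : Dec Q) (r : Dec R) → (P → Q × R) → (Q → R → P) → χ p ≡ χ q * χ r
χ-× (yes p) (yes _) (yes _) _   _   = refl
χ-× (yes p) (yes _) (no ¬r) P→ _   = ⊥-elim (¬r (proj₂ (P→ p)))
χ-× (yes p) (no ¬q) _       P→ _   = ⊥-elim (¬q (proj₁ (P→ p)))
χ-× (no ¬p) (yes q) (yes r) _  →P  = ⊥-elim (¬p (→P q r))
χ-× (no _)  (yes _) (no _)  _   _  = refl
χ-× (no _)  (no _)  _       _   _  = refl

module Triples (m B : ℕ) (a : Fin (3 * m) → ℕ) (0<B : 0 < B)
  (B<4a : ∀ v → B < 4 * a v) (2a<B : ∀ v → 2 * a v < B)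
  (class : Fin (3 * m) → Fin m) (class-weight : ∀ k → sumFin (λ v → χ (class v ≟ᶠ k) * a v) ≡ B) where

  K : ℕ
  K = 3 * m

  size : Fin m → ℕ
  size k = sumFin (λ v → χ (class v ≟ᶠ k))

  sum-class : ∀ k (f : Fin K → ℕ) → sumFin (λ v → χ (class v ≟ᶠ k) * f v) ≡ sumFin (λ v → f v * χ (class v ≟ᶠ k))
  sum-class k f = sum-cong (λ v → *-comm (χ (class v ≟ᶠ k)) (f v))

  size*suc-B≤4B : ∀ k → size k * suc B ≤ 4 * B
  size*suc-B≤4B k = begin
    size k * suc B                                    ≡⟨ sum-*ʳ (suc B) (λ v → χ (class v ≟ᶠ k)) ⟨
    sumFin (λ v → χ (class v ≟ᶠ k) * suc B)           ≤⟨ sum-mono-≤ (λ v → *-monoʳ-≤ (χ (class v ≟ᶠ k)) (B<4a v)) ⟩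
    sumFin (λ v → χ (class v ≟ᶠ k) * (4 * a v))       ≡⟨ sum-cong (λ v → *-comm (χ (class v ≟ᶠ k)) (4 * a v)) ⟩
    sumFin (λ v → 4 * a v * χ (class v ≟ᶠ k))         ≡⟨ sum-cong (λ v → *-assoc 4 (a v) _) ⟩
    sumFin (λ v → 4 * (a v * χ (class v ≟ᶠ k)))       ≡⟨ sum-*ˡ 4 (λ v → a v * χ (class v ≟ᶠ k)) ⟩
    4 * sumFin (λ v → a v * χ (class v ≟ᶠ k))         ≡⟨ cong (4 *_) (trans (sym (sum-class k a)) (class-weight k)) ⟩
    4 * B                                             ∎
    where open ≤-Reasoning

  size+2B≤size*B : ∀ k → size k + 2 * B ≤ size k * B
  size+2B≤size*B k = begin
    size k + 2 * B                                              ≡⟨ cong (size k +_) (cong (2 *_) (class-weight k)) ⟨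
    size k + 2 * sumFin (λ v → χ (class v ≟ᶠ k) * a v)          ≡⟨ cong (size k +_) (sum-*ˡ 2 (λ v → χ (class v ≟ᶠ k) * a v)) ⟨
    size k + sumFin (λ v → 2 * (χ (class v ≟ᶠ k) * a v))        ≡⟨ sum-+ (λ v → χ (class v ≟ᶠ k)) _ ⟨
    sumFin (λ v → χ (class v ≟ᶠ k) + 2 * (χ (class v ≟ᶠ k) * a v)) ≡⟨ sum-cong (λ v → reorder (χ (class v ≟ᶠ k)) (a v)) ⟩
    sumFin (λ v → χ (class v ≟ᶠ k) * suc (2 * a v))             ≤⟨ sum-mono-≤ (λ v → *-monoʳ-≤ (χ (class v ≟ᶠ k)) (2a<B v)) ⟩
    sumFin (λ v → χ (class v ≟ᶠ k) * B)                         ≡⟨ sum-*ʳ B (λ v → χ (class v ≟ᶠ k)) ⟩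
    size k * B                                                  ∎
    where
    open ≤-Reasoning
    reorder : ∀ c x → c + 2 * (c * x) ≡ c * suc (2 * x)
    reorder = solve-∀

  s*B<s+2B : ∀ s → 0 < s → s ≤ 2 → s * B < s + 2 * B
  s*B<s+2B s 0<s s≤2 = ≤-<-trans (*-monoˡ-≤ B s≤2) (m<n+m (2 * B) 0<s)

  size≡3 : ∀ k → size k ≡ 3
  size≡3 k with size k | size*suc-B≤4B k | size+2B≤size*B k
  ... | 0 | _ | 2B≤0 = ⊥-elim (<-irrefl refl (<-≤-trans (*-monoʳ-< 2 0<B) 2B≤0))
  ... | 1 | _ | 1+2B≤B  = ⊥-elim (<⇒≱ (s*B<s+2B 1 z<s (s≤s z≤n)) 1+2B≤B)
  ... | 2 | _ | 2+2B≤2B = ⊥-elim (<⇒≱ (s*B<s+2B 2 z<s ≤-refl) 2+2B≤2B)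
  ... | 3 | _ | _ = refl
  ... | suc (suc (suc (suc s))) | 4+s*sB≤4B | _ =
    ⊥-elim (<⇒≱ (*-monoʳ-< 4 (n<1+n B)) (≤-trans (m≤m+n (4 * suc B) (s * suc B)) (≤-trans (≤-reflexive (ring s (suc B))) 4+s*sB≤4B)))
    where ring : ∀ s b → 4 * b + s * b ≡ (4 + s) * b
          ring = solve-∀

  rank-in-class : Fin m → Fin K → ℕ
  rank-in-class t v = sumFin (λ u → χ (toℕ u <? toℕ v) * χ (class u ≟ᶠ t))

  suc-rank-in-class : ∀ t v → suc (rank-in-class t v) ≡ sumFin (λ u → χ (toℕ u <? toℕ v) * χ (class u ≟ᶠ t) + χ (u ≟ᶠ v))
  suc-rank-in-class t v = begin
    suc (rank-in-class t v)                                               ≡⟨ +-comm 1 _ ⟩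
    rank-in-class t v + 1                                                 ≡⟨ cong (rank-in-class t v +_) (sum-δ v) ⟨
    rank-in-class t v + sumFin (λ u → χ (u ≟ᶠ v))                         ≡⟨ sum-+ (λ u → χ (toℕ u <? toℕ v) * χ (class u ≟ᶠ t)) _ ⟨
    sumFin (λ u → χ (toℕ u <? toℕ v) * χ (class u ≟ᶠ t) + χ (u ≟ᶠ v))     ∎
    where open ≡-Reasoning

  rank-in-class-< : ∀ {v w} → toℕ v < toℕ w → suc (rank-in-class (class v) v) ≤ rank-in-class (class v) w
  rank-in-class-< {v} {w} v<w = begin
    suc (rank-in-class t v)                                               ≡⟨ suc-rank-in-class t v ⟩
    sumFin (λ u → χ (toℕ u <? toℕ v) * χ (class u ≟ᶠ t) + χ (u ≟ᶠ v))     ≤⟨ sum-mono-≤ step ⟩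
    rank-in-class t w                                                     ∎
    where
    open ≤-Reasoning
    t : Fin m
    t = class v
    step : ∀ u → χ (toℕ u <? toℕ v) * χ (class u ≟ᶠ t) + χ (u ≟ᶠ v) ≤ χ (toℕ u <? toℕ w) * χ (class u ≟ᶠ t)
    step u with u ≟ᶠ v
    ... | yes refl rewrite χ-no (toℕ u <? toℕ u) (<-irrefl refl) | χ-yes (toℕ u <? toℕ w) v<w | χ-yes (class u ≟ᶠ t) refl = ≤-refl
    ... | no _ = ≤-trans (≤-reflexive (+-identityʳ _)) (*-monoˡ-≤ (χ (class u ≟ᶠ t)) (χ-mono (toℕ u)))
      where χ-mono : ∀ r → χ (r <? toℕ v) ≤ χ (r <? toℕ w)
            χ-mono r with r <? toℕ v | r <? toℕ w
            ... | no _    | _       = z≤n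
            ... | yes _   | yes _   = ≤-refl
            ... | yes r<v | no r≮w  = ⊥-elim (r≮w (<-trans r<v v<w))

  rank-in-class<3 : ∀ v → rank-in-class (class v) v < 3
  rank-in-class<3 v = begin
    suc (rank-in-class t v)                                               ≡⟨ suc-rank-in-class t v ⟩
    sumFin (λ u → χ (toℕ u <? toℕ v) * χ (class u ≟ᶠ t) + χ (u ≟ᶠ v))     ≤⟨ sum-mono-≤ step ⟩
    size t                                                                ≡⟨ size≡3 t ⟩
    3                                                                     ∎
    where
    open ≤-Reasoning
    t : Fin m
    t = class v
    step : ∀ u → χ (toℕ u <? toℕ v) * χ (class u ≟ᶠ t) + χ (u ≟ᶠ v) ≤ χ (class u ≟ᶠ t)
    step u with u ≟ᶠ v
    ... | yes refl rewrite χ-no (toℕ u <? toℕ u) (<-irrefl refl) | χ-yes (class u ≟ᶠ t) refl = ≤-refl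
    ... | no _ = ≤-trans (≤-reflexive (+-identityʳ _)) (≤-trans (*-monoˡ-≤ (χ (class u ≟ᶠ t)) (χ≤1 (toℕ u <? toℕ v)))
                                                               (≤-reflexive (+-identityʳ _)))

  slot : Fin K → Fin 3
  slot v = fromℕ< (rank-in-class<3 v)

  position : Fin K → Fin (m * 3)
  position v = combine (class v) (slot v)

  same-rank : ∀ {v w} → class v ≡ class w → slot v ≡ slot w → rank-in-class (class v) v ≡ rank-in-class (class v) w
  same-rank {v} {w} cv≡cw sv≡sw = begin
    rank-in-class (class v) v ≡⟨ toℕ-fromℕ< (rank-in-class<3 v) ⟨
    toℕ (slot v)              ≡⟨ cong toℕ sv≡sw ⟩
    toℕ (slot w)              ≡⟨ toℕ-fromℕ< (rank-in-class<3 w) ⟩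
    rank-in-class (class w) w ≡⟨ cong (λ t → rank-in-class t w) cv≡cw ⟨
    rank-in-class (class v) w ∎
    where open ≡-Reasoning

  position-injective : Injective _≡_ _≡_ position
  position-injective {v} {w} eq = by-order (<-cmp (toℕ v) (toℕ w))
    where
    same : class v ≡ class w × slot v ≡ slot w
    same = combine-injective (class v) (slot v) (class w) (slot w) eq
    by-order : Tri (toℕ v < toℕ w) (toℕ v ≡ toℕ w) (toℕ w < toℕ v) → v ≡ w
    by-order (tri< v<w _ _) = ⊥-elim (<-irrefl (same-rank {v} {w} (proj₁ same) (proj₂ same)) (rank-in-class-< {v} {w} v<w))
    by-order (tri≈ _ v≡w _) = toℕ-injective v≡w
    by-order (tri> _ _ w<v) = ⊥-elim (<-irrefl (same-rank {w} {v} (sym (proj₁ same)) (sym (proj₂ same))) (rank-in-class-< {w} {v} w<v))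

  index : Fin K → ℕ
  index v = toℕ (position v)

  index<K : ∀ v → index v < K
  index<K v = subst (index v <_) (*-comm m 3) (toℕ<n (position v))

  index-injective : Injective _≡_ _≡_ index
  index-injective {v} {w} e = position-injective {v} {w} (toℕ-injective {i = position v} {j = position w} e)

  σ-spec : ∀ (k : Fin m) (j : Fin 3) → ∃[ v ] index v ≡ toℕ (combine k j)
  σ-spec k j = ∃-preimage index index-injective index<K (toℕ (combine k j))
                 (subst (toℕ (combine k j) <_) (*-comm m 3) (toℕ<n (combine k j)))

  σ : Fin m × Fin 3 → Fin K
  σ (k , j) = proj₁ (σ-spec k j)

  position-σ : ∀ (k : Fin m) (j : Fin 3) → position (σ (k , j)) ≡ combine k j
  position-σ k j = toℕ-injective {i = position (σ (k , j))} {j = combine k j} (proj₂ (σ-spec k j))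


  σ-injective : Injective _≡_ _≡_ σ
  σ-injective {k , j} {k′ , j′} eq = cong₂ _,_ (proj₁ same) (proj₂ same)
    where
    same : k ≡ k′ × j ≡ j′
    same = combine-injective k j k′ j′ (trans (sym (position-σ k j)) (trans (cong position eq) (position-σ k′ j′)))

  σ-surjective : ∀ v → ∃[ p ] σ p ≡ v
  σ-surjective v = (class v , slot v) , position-injective {σ (class v , slot v)} {v} (position-σ (class v) (slot v))

  χ-σ : ∀ v (k : Fin m) (j : Fin 3) → χ (v ≟ᶠ σ (k , j)) ≡ χ (class v ≟ᶠ k) * χ (j ≟ᶠ slot v)
  χ-σ v k j = χ-× (v ≟ᶠ σ (k , j)) (class v ≟ᶠ k) (j ≟ᶠ slot v) split join
    where
    split : v ≡ σ (k , j) → class v ≡ k × j ≡ slot v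
    split refl = let (c , s) = combine-injective (class v) (slot v) k j (position-σ k j) in c , sym s
    join : class v ≡ k → j ≡ slot v → v ≡ σ (k , j)
    join refl refl = position-injective {v} {σ (class v , slot v)} (sym (position-σ (class v) (slot v)))

  triple-weight : ∀ k → a (σ (k , fzero)) + a (σ (k , fsuc fzero)) + a (σ (k , fsuc (fsuc fzero))) ≡ B
  triple-weight k = begin
    a (σ (k , fzero)) + a (σ (k , fsuc fzero)) + a (σ (k , fsuc (fsuc fzero)))
      ≡⟨ trans (+-assoc (a (σ (k , fzero))) _ _)
               (cong (λ x → a (σ (k , fzero)) + (a (σ (k , fsuc fzero)) + x)) (sym (+-identityʳ (a (σ (k , fsuc (fsuc fzero))))))) ⟩
    sumFin (λ j → a (σ (k , j)))
      ≡⟨ sum-cong (λ j → sum-select (σ (k , j)) a) ⟨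
    sumFin (λ j → sumFin (λ v → χ (v ≟ᶠ σ (k , j)) * a v))
      ≡⟨ sum-comm {3} {K} (λ j v → χ (v ≟ᶠ σ (k , j)) * a v) ⟩
    sumFin (λ v → sumFin (λ j → χ (v ≟ᶠ σ (k , j)) * a v))
      ≡⟨ sum-cong in-class ⟩
    sumFin (λ v → χ (class v ≟ᶠ k) * a v)
      ≡⟨ class-weight k ⟩
    B ∎
    where
    open ≡-Reasoning
    in-class : ∀ v → sumFin (λ j → χ (v ≟ᶠ σ (k , j)) * a v) ≡ χ (class v ≟ᶠ k) * a v
    in-class v = trans (sum-cong {3} (λ j → trans (cong (_* a v) (χ-σ v k j)) (ring (χ (class v ≟ᶠ k)) (χ (j ≟ᶠ slot v)) (a v))))
                       (sum-select (slot v) (λ _ → χ (class v ≟ᶠ k) * a v))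
      where ring : ∀ c d x → c * d * x ≡ d * (c * x)
            ring = solve-∀

  yes-instance : YesInstance m B a
  yes-instance = σ , σ-injective , σ-surjective , triple-weight

degrees : ∀ {n} → Digraph n → Fin n → ℕ × ℕ
degrees E v = (indeg E v , outdeg E v)

lookup-++-↑ˡ : ∀ {A : Set} (xs ys : List A) {k n} (i : Fin k) .(eq : k + n ≡ length (xs ++ ys)) (|xs| : k ≡ length xs) →
  lookup (xs ++ ys) (cast eq (i ↑ˡ n)) ≡ lookup xs (cast |xs| i)
lookup-++-↑ˡ (x ∷ xs) ys fzero    eq refl = refl
lookup-++-↑ˡ (x ∷ xs) ys (fsuc i) eq refl = lookup-++-↑ˡ xs ys i (suc-injective eq) refl

lookup-++-↑ʳ : ∀ {A : Set} (xs ys : List A) {k n} (p : Fin n) .(eq : k + n ≡ length (xs ++ ys)) (|xs| : k ≡ length xs)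
  .(|ys| : n ≡ length ys) → lookup (xs ++ ys) (cast eq (k ↑ʳ p)) ≡ lookup ys (cast |ys| p)
lookup-++-↑ʳ []       ys p eq refl |ys| = refl
lookup-++-↑ʳ (x ∷ xs) ys p eq refl |ys| = lookup-++-↑ʳ xs ys p (suc-injective eq) refl |ys|

realization-cast : ∀ {n} (S : DegSeq) (eq : length S ≡ n) → DagRealizable S →
  Σ (Digraph n) λ E → IsDag E × ∀ v → degrees E v ≡ lookup S (cast (sym eq) v)
realization-cast S refl (E , dag , deg) = E , dag , λ v → trans (×-≡,≡→≡ (deg v)) (cong (lookup S) (sym (cast-is-id refl v)))

realization-++ : ∀ {K N} (xs ys : DegSeq) (|xs| : length xs ≡ K) (|ys| : length ys ≡ N) → DagRealizable (xs ++ ys) →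
  Σ (Digraph (K + N)) λ E → IsDag E ×
    (∀ i → degrees E (i ↑ˡ N) ≡ lookup xs (cast (sym |xs|) i)) × (∀ p → degrees E (K ↑ʳ p) ≡ lookup ys (cast (sym |ys|) p))
realization-++ xs ys |xs| |ys| realizable =
  let |xs++ys| = trans (length-++ xs) (cong₂ _+_ |xs| |ys|)
      (E , dag , deg) = realization-cast (xs ++ ys) |xs++ys| realizable
  in E , dag , (λ i → trans (deg (i ↑ˡ _)) (lookup-++-↑ˡ xs ys i (sym |xs++ys|) (sym |xs|)))
               , (λ p → trans (deg (_ ↑ʳ p)) (lookup-++-↑ʳ xs ys p (sym |xs++ys|) (sym |xs|) (sym |ys|)))

module _ (m′ B′ : ℕ) (a : Fin (3 * suc m′) → ℕ) where

  open Construction m′ B′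

  construction-realization : DagRealizable (constructS m B a) →
    Σ (Digraph (3 * m + N)) λ E → IsDag E ×
      (∀ i → indeg E (i ↑ˡ N) ≡ a i × outdeg E (i ↑ˡ N) ≡ a i) ×
      (∀ p → indeg E (3 * m ↑ʳ p) ≡ toℕ p + e (toℕ p) × outdeg E (3 * m ↑ʳ p) ≡ N ∸ (toℕ p + e (toℕ p)))
  construction-realization realizable =
    let (E , dag , deg-α , deg-x) = realization-++ (tabulate α) (applyUpTo xdeg N) (length-tabulate α) |x|
                                      (subst DagRealizable (cong (tabulate α ++_) X-xdeg) realizable)
    in E , dag , (λ i → ×-≡,≡←≡ (trans (deg-α i) (lookup-tabulate α i)))
             , (λ p → ×-≡,≡←≡ (trans (deg-x p) (trans (lookup-applyUpTo xdeg N (cast (sym |x|) p))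
                                                       (cong xdeg (toℕ-cast (sym |x|) p)))))
    where
    α : Fin (3 * m) → ℕ × ℕ
    α i = (a i , a i)
    |x| : length (applyUpTo xdeg N) ≡ N
    |x| = length-applyUpTo xdeg N

  yes-instance-of-realization : (∀ i → 0 < a i) → sumFin a ≡ m * B → (∀ i → B < 4 * a i) → (∀ i → 2 * a i < B) →
    (E : Digraph (3 * m + N)) → IsDag E →
    (∀ i → indeg E (i ↑ˡ N) ≡ a i × outdeg E (i ↑ˡ N) ≡ a i) →
    (∀ p → indeg E (3 * m ↑ʳ p) ≡ toℕ p + e (toℕ p) × outdeg E (3 * m ↑ʳ p) ≡ N ∸ (toℕ p + e (toℕ p))) →
    YesInstance m B a
  yes-instance-of-realization 0<a sum-a B<4a 2a<B E dag deg-A deg-X =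
    Triples.yes-instance m B a z<s B<4a 2a<B level level-weight
    where
    open Realization (3 * m) N a e e-01 E dag deg-A deg-X (trans (cong (2 *_) sum-a) (sym (*-assoc 2 m B)))
    m*2B≡N : m * (2 * B) ≡ N
    m*2B≡N = trans (sym (*-assoc m 2 B)) (cong (_* B) (*-comm m 2))
    S : ℕ → Fin (3 * m) → Bool
    S j = reaches-below (j * (2 * B))
    S-weight : ∀ j → j ≤ m → sumFin (λ v → ind (S j v) * a v) ≡ j * B
    S-weight j j≤m = trans (weight-reaches-below (j * (2 * B)) (trans (weight-e N j θ≤N) (sym (weight-1∸e N j θ≤N))))
                           (weight-e N j θ≤N)
      where θ≤N : j * (2 * B) ≤ N
            θ≤N = ≤-trans (*-monoˡ-≤ (2 * B) j≤m) (≤-reflexive m*2B≡N)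
    open Levels m B a S (λ v j≤j′ → reaches-below-mono v (*-monoˡ-≤ (2 * B) j≤j′)) ¬reaches-below-0
      (λ v → reaches-below-N v (≤-reflexive (sym m*2B≡N)) (0<a v)) S-weight

lemma3 : (m B : ℕ) (a : Fin (3 * m) → ℕ)
    → (∀ i → 0 < a i)
    → sumFin a ≡ m * B
    → (∀ i → B < 4 * a i)
    → (∀ i → 2 * a i < B)
    → DagRealizable (constructS m B a)
    → YesInstance m B a
lemma3 zero     B        a _ _ _ _ _ = (λ ()) , (λ { {() , _} }) , (λ ()) , (λ ())
lemma3 (suc m′) zero     a _ _ _ 2a<0 _ with () ← 2a<0 fzero
lemma3 (suc m′) (suc B′) a 0<a sum-a B<4a 2a<B realizable =
  let (E , dag , deg-A , deg-X) = construction-realization m′ B′ a realizable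
  in yes-instance-of-realization m′ B′ a 0<a sum-a B<4a 2a<B E dag deg-A deg-X
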